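{- For an integer $m\ge 3$, let $G_{4m}$ be the graph with vertex set $\{x,y,z\}\cup\{y_1,\dots,y_{2m-2}\}\cup\{z_1,\dots,z_{2m-1}\}$ and edge set $\{yz\}\cup\{xy_i,\ y_iy: 1\le i\le 2m-2\}\cup\{xz_i,\ z_iz: 1\le i\le 2m-1\}\cup\{y_iy_j: 1\le i<j\le 2m-2,\ j\ne i+m-1\}\cup\{z_iz_{1+((i+m-2)\bmod (2m-1))}: 1\le i\le 2m-1\}\cup\{y_iz_j: 1\le i\le 2m-2,\ 1\le j\le 2m-1,\ j\ne i,\ j\ne i+1\}\cup\{y_1z_2\}$. Then $\gamma_t(G_{4m})=3$.
   Context: A set $S\subseteq V(G)$ is a total dominating set of a graph $G$ if every vertex of $G$ (including those in $S$) is adjacent to some vertex of $S$; $\gamma_t(G)$ is the minimum cardinality of a total dominating set. -}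

module Defs where

open import Data.Nat using (ℕ; zero; suc; _+_; _*_; _∸_; _≤_; _<_)
open import Data.Nat.DivMod using (_%_)
open import Data.Fin using (Fin; toℕ)
open import Data.List using (List; length)
open import Data.List.Membership.Propositional using (_∈_)
open import Data.List.Relation.Unary.Unique.Propositional using (Unique)
open import Data.Product using (Σ; _×_; ∃-syntax)
open import Data.Sum using (_⊎_)
open import Relation.Binary.PropositionalEquality using (_≡_; _≢_)

IsTotalDominatingSet : {V : Set} → (V → V → Set) → List V → Set
IsTotalDominatingSet {V} Adj S = (v : V) → ∃[ u ] (u ∈ S × Adj v u)

TotalDominationNumberIs : {V : Set} → (V → V → Set) → ℕ → Set
TotalDominationNumberIs {V} Adj k =
  (∃[ S ] (Unique S × IsTotalDominatingSet Adj S × length S ≡ k))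
  × ((S : List V) → Unique S → IsTotalDominatingSet Adj S → k ≤ length S)

-- Index conventions: y_i (1 ≤ i ≤ 2m-2) is  yv i  with  i : Fin (2m-2),
-- z_j (1 ≤ j ≤ 2m-1) is  zv j  with  j : Fin zSize,  zSize m = 2m-1
-- (written as suc (2m-2) so that it is syntactically nonzero).
-- Paper index = toℕ + 1.

zSize : ℕ → ℕ
zSize m = suc (2 * m ∸ 2)

data V (m : ℕ) : Set where
  xv yv0 zv0 : V m
  yv : Fin (2 * m ∸ 2) → V m
  zv : Fin (zSize m) → V m

-- The listed edges (one orientation each).
data E (m : ℕ) : V m → V m → Set where
  e-yz   : E m yv0 zv0
  e-xyi  : ∀ i → E m xv (yv i)
  e-yiy  : ∀ i → E m (yv i) yv0
  e-xzi  : ∀ i → E m xv (zv i)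
  e-ziz  : ∀ i → E m (zv i) zv0
  e-yy   : ∀ i j → toℕ i < toℕ j → toℕ j ≢ toℕ i + (m ∸ 1) → E m (yv i) (yv j)
  -- z_i z_{1 + ((i + m - 2) mod (2m-1))}; with 0-based a = i-1, b = j-1:
  -- b = (a + m - 1) mod (2m-1)
  e-zz   : ∀ i j → toℕ j ≡ (toℕ i + (m ∸ 1)) % zSize m → E m (zv i) (zv j)
  -- y_i z_j, j ≠ i, j ≠ i+1 (same in 0-based indices)
  e-yz'  : ∀ i j → toℕ j ≢ toℕ i → toℕ j ≢ suc (toℕ i) → E m (yv i) (zv j)
  e-y1z2 : ∀ i j → toℕ i ≡ 0 → toℕ j ≡ 1 → E m (yv i) (zv j)

Adj : (m : ℕ) → V m → V m → Set
Adj m u v = E m u v ⊎ E m v u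

-- {x, y₁, z₁} is a total dominating set. Conversely no two vertices u, v
-- totally dominate, because u and v always have a common non-neighbour.
-- The only delicate pair is y_i, z_k: the candidates are z_i and z_{i+1}
-- (never adjacent to y_i), and the unique y_p with |p - i| = m - 1 (never
-- adjacent to y_i); y_p misses z_k when k ∈ {p, p + 1} (barring the extra
-- edge y₁z₂), and in the remaining cases one of z_i, z_{i+1} is off the
-- chords of z_k.
module Submission where

open import Defs
open import Data.Fin using (Fin; toℕ; fromℕ<; inject₁) renaming (zero to fz; suc to fs)
open import Data.Fin.Properties using (toℕ<n; toℕ-fromℕ<; toℕ-inject₁)
open import Data.List using (List; []; _∷_; length)
open import Data.List.Relation.Unary.All using ([]; _∷_)
open import Data.List.Relation.Unary.AllPairs using ([]; _∷_)
open import Data.List.Relation.Unary.Unique.Propositional using (Unique)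
open import Data.List.Relation.Unary.Any using (here; there)
open import Data.Nat using (ℕ; suc; _+_; _*_; _∸_; _≤_; _<_; z≤n; s≤s; s≤s⁻¹; NonZero; _≟_; _<?_)
open import Data.Nat.DivMod using (_%_; m<n⇒m%n≡m; m≤n⇒[n∸m]%m≡n%m)
open import Data.Nat.Properties
open import Data.Product using (Σ-syntax; ∃; ∃-syntax; _×_; _,_)
open import Data.Sum using (_⊎_; inj₁; inj₂; [_,_]′; swap)
open import Function using (_∘_)
open import Relation.Nullary using (¬_; yes; no; contradiction)
open import Relation.Binary.PropositionalEquality

CommonNonNeighbour : {A : Set} → (A → A → Set) → A → A → A → Set
CommonNonNeighbour _∼_ u v w = ¬ w ∼ u × ¬ w ∼ v

commonNonNeighbours⇒3≤length : {A : Set} {_∼_ : A → A → Set} → A →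
  (∀ u v → ∃ (CommonNonNeighbour _∼_ u v)) →
  (S : List A) → IsTotalDominatingSet _∼_ S → 3 ≤ length S
commonNonNeighbours⇒3≤length a _ [] dom with dom a
... | _ , () , _
commonNonNeighbours⇒3≤length _ cnn (u ∷ []) dom with cnn u u
... | w , w≁u , _ with dom w
...   | _ , here refl , w∼u = contradiction w∼u w≁u
commonNonNeighbours⇒3≤length _ cnn (u ∷ v ∷ []) dom with cnn u v
... | w , w≁u , w≁v with dom w
...   | _ , here refl , w∼u = contradiction w∼u w≁u
...   | _ , there (here refl) , w∼v = contradiction w∼v w≁v
commonNonNeighbours⇒3≤length _ _ (_ ∷ _ ∷ _ ∷ _) _ = s≤s (s≤s (s≤s z≤n))

[m+n]%o-wrap : ∀ {m n o} .{{_ : NonZero o}} → m < o → n < o →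
  (m + n) % o ≡ m + n ⊎ (m + n) % o + o ≡ m + n
[m+n]%o-wrap {m} {n} {o} m<o n<o with m + n <? o
... | yes m+n<o = inj₁ (m<n⇒m%n≡m m+n<o)
... | no m+n≮o = inj₂ wrapped
  where
  o≤m+n : o ≤ m + n
  o≤m+n = ≮⇒≥ m+n≮o
  m+n∸o<o : m + n ∸ o < o
  m+n∸o<o = +-cancelʳ-< o _ o (begin-strict
    m + n ∸ o + o   ≡⟨ m∸n+n≡m o≤m+n ⟩
    m + n           <⟨ +-mono-<-≤ m<o (<⇒≤ n<o) ⟩
    o + o           ∎)
    where open ≤-Reasoning
  wrapped : (m + n) % o + o ≡ m + n
  wrapped = begin
    (m + n) % o + o       ≡⟨ cong (_+ o) (sym (m≤n⇒[n∸m]%m≡n%m o≤m+n)) ⟩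
    (m + n ∸ o) % o + o   ≡⟨ cong (_+ o) (m<n⇒m%n≡m m+n∸o<o) ⟩
    m + n ∸ o + o         ≡⟨ m∸n+n≡m o≤m+n ⟩
    m + n                 ∎
    where open ≡-Reasoning

-- G₄ₘ for m = 3 + n; c = m - 1 is the chord length of the z-cycle.
module G₄ₘ (n : ℕ) where

  c : ℕ
  c = suc (suc n)

  m : ℕ
  m = suc c

  -- Jump a b: b ≡ a + c modulo 2c + 1, for a, b ≤ 2c.
  Jump : ℕ → ℕ → Set
  Jump a b = b ≡ a + c ⊎ b + suc c ≡ a

  Chord : ℕ → ℕ → Set
  Chord a b = Jump a b ⊎ Jump b a

  ¬Chord-low : ∀ {i k} → i < c → k ≢ i + c → k ≢ suc (i + c) → ¬ Chord i k
  ¬Chord-low _   k≢i+c _ (inj₁ (inj₁ k≡i+c)) = k≢i+c k≡i+c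
  ¬Chord-low i<c _ _ (inj₁ (inj₂ k+c+1≡i)) = <-asym i<c (m+n≤o⇒n≤o _ (≤-reflexive k+c+1≡i))
  ¬Chord-low i<c _ _ (inj₂ (inj₁ i≡k+c)) = <⇒≱ i<c (m+n≤o⇒n≤o _ (≤-reflexive (sym i≡k+c)))
  ¬Chord-low {i} _ _ k≢i+c+1 (inj₂ (inj₂ i+c+1≡k)) = k≢i+c+1 (trans (sym i+c+1≡k) (+-suc i c))

  ¬Chord-high : ∀ {a p k} → a ≡ suc (p + c) → k ≤ c + c → k ≢ p → k ≢ suc p → ¬ Chord a k
  ¬Chord-high {p = p} refl k≤c+c _ _ (inj₁ (inj₁ k≡a+c)) =
    <⇒≱ (+-mono-<-≤ (s≤s (m≤n+m c p)) ≤-refl) (≤-trans (≤-reflexive (sym k≡a+c)) k≤c+c)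
  ¬Chord-high {p = p} {k} refl _ k≢p _ (inj₁ (inj₂ k+c+1≡a)) =
    k≢p (+-cancelʳ-≡ c k p (suc-injective (trans (sym (+-suc k c)) k+c+1≡a)))
  ¬Chord-high {p = p} {k} refl _ _ k≢p+1 (inj₂ (inj₁ a≡k+c)) = k≢p+1 (sym (+-cancelʳ-≡ c (suc p) k a≡k+c))
  ¬Chord-high {p = p} refl k≤c+c _ _ (inj₂ (inj₂ a+c+1≡k)) =
    <⇒≱ (+-mono-≤-< (≤-trans (m≤n+m c p) (n≤1+n _)) (n<1+n c)) (≤-trans (≤-reflexive a+c+1≡k) k≤c+c)

  ¬Chord-c-1 : ∀ {a k} → a ≡ c → k ≡ 1 → ¬ Chord a k
  ¬Chord-c-1 refl refl (inj₁ (inj₁ ()))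
  ¬Chord-c-1 refl refl (inj₁ (inj₂ c+2≡c)) = m≢1+n+m c {1} (sym c+2≡c)
  ¬Chord-c-1 refl refl (inj₂ (inj₁ c≡c+1)) = 1+n≢n (sym c≡c+1)
  ¬Chord-c-1 refl refl (inj₂ (inj₂ ()))

  2m-2≡c+c : 2 * m ∸ 2 ≡ c + c
  2m-2≡c+c = trans (sym (*-distribˡ-∸ 2 m 1)) (cong (c +_) (+-identityʳ c))

  toℕ-yIndex< : (i : Fin (2 * m ∸ 2)) → toℕ i < c + c
  toℕ-yIndex< i = subst (toℕ i <_) 2m-2≡c+c (toℕ<n i)

  toℕ-zIndex≤ : (k : Fin (zSize m)) → toℕ k ≤ c + c
  toℕ-zIndex≤ k = s≤s⁻¹ (subst (λ t → toℕ k < suc t) 2m-2≡c+c (toℕ<n k))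

  yIndex : ∀ {p} → p < c + c → Σ[ q ∈ Fin (2 * m ∸ 2) ] toℕ q ≡ p
  yIndex {p} p<c+c = fromℕ< p<Y , toℕ-fromℕ< p<Y
    where p<Y = subst (p <_) (sym 2m-2≡c+c) p<c+c

  partner : (i : Fin (2 * m ∸ 2)) →
    (Σ[ p ∈ Fin (2 * m ∸ 2) ] toℕ p ≡ toℕ i + c) ⊎ (Σ[ p ∈ Fin (2 * m ∸ 2) ] toℕ i ≡ toℕ p + c)
  partner i with toℕ i <? c
  ... | yes i<c = inj₁ (yIndex (+-monoˡ-< c i<c))
  ... | no i≮c with yIndex (≤-<-trans (m∸n≤m (toℕ i) c) (toℕ-yIndex< i))
  ...   | p , p≡i∸c = inj₂ (p , sym (trans (cong (_+ c) p≡i∸c) (m∸n+n≡m (≮⇒≥ i≮c))))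

  E-zz⇒Jump : ∀ {a b} → E m (zv a) (zv b) → Jump (toℕ a) (toℕ b)
  E-zz⇒Jump {a} {b} (e-zz _ _ b≡[a+c]%N) with [m+n]%o-wrap (toℕ<n a) c<N
    where c<N = s≤s (≤-trans (m≤m+n c c) (≤-reflexive (sym 2m-2≡c+c)))
  ... | inj₁ [a+c]%N≡a+c = inj₁ (trans b≡[a+c]%N [a+c]%N≡a+c)
  ... | inj₂ [a+c]%N+N≡a+c = inj₂ (+-cancelʳ-≡ c _ _ (begin
    toℕ b + suc c + c              ≡⟨ +-assoc (toℕ b) (suc c) c ⟩
    toℕ b + suc (c + c)            ≡⟨ cong (λ t → toℕ b + suc t) (sym 2m-2≡c+c) ⟩
    toℕ b + zSize m                ≡⟨ cong (_+ zSize m) b≡[a+c]%N ⟩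
    (toℕ a + c) % zSize m + zSize m ≡⟨ [a+c]%N+N≡a+c ⟩
    toℕ a + c                      ∎))
    where open ≡-Reasoning

  ≁-sym : ∀ {u v} → ¬ Adj m u v → ¬ Adj m v u
  ≁-sym u≁v = u≁v ∘ swap

  zz-nonadjacent : ∀ a b → ¬ Chord (toℕ a) (toℕ b) → ¬ Adj m (zv a) (zv b)
  zz-nonadjacent _ _ ¬chord (inj₁ e) = ¬chord (inj₁ (E-zz⇒Jump e))
  zz-nonadjacent _ _ ¬chord (inj₂ e) = ¬chord (inj₂ (E-zz⇒Jump e))

  yy-nonadjacent : ∀ p q → toℕ q ≡ toℕ p + c → ¬ Adj m (yv p) (yv q)
  yy-nonadjacent _ _ q≡p+c (inj₁ (e-yy _ _ _ q≢p+c)) = q≢p+c q≡p+c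
  yy-nonadjacent p _ q≡p+c (inj₂ (e-yy _ _ q<p _)) =
    <⇒≱ q<p (≤-trans (m≤m+n (toℕ p) c) (≤-reflexive (sym q≡p+c)))

  yz-nonadjacent-same : ∀ p k → toℕ k ≡ toℕ p → ¬ Adj m (yv p) (zv k)
  yz-nonadjacent-same _ _ k≡p (inj₁ (e-yz' _ _ k≢p _)) = k≢p k≡p
  yz-nonadjacent-same _ _ k≡p (inj₁ (e-y1z2 _ _ p≡0 k≡1)) = 0≢1+n (trans (sym p≡0) (trans (sym k≡p) k≡1))
  yz-nonadjacent-same _ _ _ (inj₂ ())

  yz-nonadjacent-next : ∀ p k → toℕ k ≡ suc (toℕ p) → toℕ p ≢ 0 → ¬ Adj m (yv p) (zv k)
  yz-nonadjacent-next _ _ k≡p+1 _ (inj₁ (e-yz' _ _ _ k≢p+1)) = k≢p+1 k≡p+1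
  yz-nonadjacent-next _ _ _ p≢0 (inj₁ (e-y1z2 _ _ p≡0 _)) = p≢0 p≡0
  yz-nonadjacent-next _ _ _ _ (inj₂ ())

  z-nonadjacent-y : ∀ i → ¬ Adj m (zv (inject₁ i)) (yv i)
  z-nonadjacent-y i = ≁-sym (yz-nonadjacent-same i (inject₁ i) (toℕ-inject₁ i))

  y-nonadjacent-z : ∀ k → ∃[ p ] ¬ Adj m (yv p) (zv k)
  y-nonadjacent-z fz = fz , yz-nonadjacent-same fz fz refl
  y-nonadjacent-z (fs fz) with yIndex {1} (s≤s (s≤s z≤n))
  ... | p , p≡1 = p , yz-nonadjacent-same p (fs fz) (sym p≡1)
  y-nonadjacent-z (fs (fs k)) = fs k , yz-nonadjacent-next (fs k) (fs (fs k)) refl λ ()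

  yz-commonNonNeighbour-below : ∀ i p k → toℕ p ≡ toℕ i + c →
    ∃ (CommonNonNeighbour (Adj m) (yv i) (zv k))
  yz-commonNonNeighbour-below i p k p≡i+c with toℕ k ≟ toℕ i + c | toℕ k ≟ suc (toℕ i + c)
  ... | yes k≡i+c | _ =
    yv p , p≁i , yz-nonadjacent-same p k (trans k≡i+c (sym p≡i+c))
    where p≁i = ≁-sym (yy-nonadjacent i p p≡i+c)
  ... | no _ | yes k≡i+c+1 =
    yv p , p≁i , yz-nonadjacent-next p k (trans k≡i+c+1 (cong suc (sym p≡i+c))) p≢0
    where
    p≁i = ≁-sym (yy-nonadjacent i p p≡i+c)
    p≢0 = m+1+n≢0 (toℕ i) ∘ trans (sym p≡i+c)
  ... | no k≢i+c | no k≢i+c+1 =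
    zv (inject₁ i) , z-nonadjacent-y i ,
    zz-nonadjacent (inject₁ i) k (subst (λ a → ¬ Chord a (toℕ k)) (sym (toℕ-inject₁ i)) (¬Chord-low i<c k≢i+c k≢i+c+1))
    where i<c = +-cancelʳ-< c (toℕ i) c (subst (_< c + c) p≡i+c (toℕ-yIndex< p))

  yz-commonNonNeighbour-above : ∀ i p k → toℕ i ≡ toℕ p + c →
    ∃ (CommonNonNeighbour (Adj m) (yv i) (zv k))
  yz-commonNonNeighbour-above i p k i≡p+c with toℕ k ≟ toℕ p | toℕ k ≟ suc (toℕ p) | toℕ p ≟ 0
  ... | yes k≡p | _ | _ = yv p , yy-nonadjacent p i i≡p+c , yz-nonadjacent-same p k k≡p
  ... | no _ | yes k≡p+1 | no p≢0 = yv p , yy-nonadjacent p i i≡p+c , yz-nonadjacent-next p k k≡p+1 p≢0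
  ... | no _ | yes k≡p+1 | yes p≡0 =
    zv (inject₁ i) , z-nonadjacent-y i , zz-nonadjacent (inject₁ i) k (¬Chord-c-1 i≡c k≡1)
    where
    i≡c = trans (toℕ-inject₁ i) (trans i≡p+c (cong (_+ c) p≡0))
    k≡1 = trans k≡p+1 (cong suc p≡0)
  ... | no k≢p | no k≢p+1 | _ =
    zv (fs i) , ≁-sym (yz-nonadjacent-next i (fs i) refl i≢0) ,
    zz-nonadjacent (fs i) k (¬Chord-high (cong suc i≡p+c) (toℕ-zIndex≤ k) k≢p k≢p+1)
    where i≢0 = m+1+n≢0 (toℕ p) ∘ trans (sym i≡p+c)

  yz-commonNonNeighbour : ∀ i k → ∃ (CommonNonNeighbour (Adj m) (yv i) (zv k))
  yz-commonNonNeighbour i k with partner i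
  ... | inj₁ (p , p≡i+c) = yz-commonNonNeighbour-below i p k p≡i+c
  ... | inj₂ (p , i≡p+c) = yz-commonNonNeighbour-above i p k i≡p+c

  commonNonNeighbour : ∀ u v → ∃ (CommonNonNeighbour (Adj m) u v)
  commonNonNeighbour (yv i) (zv k) = yz-commonNonNeighbour i k
  commonNonNeighbour (zv k) (yv i) with yz-commonNonNeighbour i k
  ... | w , w≁i , w≁k = w , w≁k , w≁i
  commonNonNeighbour yv0 (yv i) = zv (inject₁ i) , [ (λ ()) , (λ ()) ]′ , z-nonadjacent-y i
  commonNonNeighbour (yv i) yv0 = zv (inject₁ i) , z-nonadjacent-y i , [ (λ ()) , (λ ()) ]′
  commonNonNeighbour zv0 (zv k) with y-nonadjacent-z k
  ... | p , p≁k = yv p , [ (λ ()) , (λ ()) ]′ , p≁k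
  commonNonNeighbour (zv k) zv0 with y-nonadjacent-z k
  ... | p , p≁k = yv p , p≁k , [ (λ ()) , (λ ()) ]′
  -- x is adjacent only to the y_i and z_j, z₀ only to y and the z_j, and y
  -- only to z₀ and the y_i.
  commonNonNeighbour xv xv = xv , [ (λ ()) , (λ ()) ]′ , [ (λ ()) , (λ ()) ]′
  commonNonNeighbour xv yv0 = xv , [ (λ ()) , (λ ()) ]′ , [ (λ ()) , (λ ()) ]′
  commonNonNeighbour xv zv0 = xv , [ (λ ()) , (λ ()) ]′ , [ (λ ()) , (λ ()) ]′
  commonNonNeighbour yv0 xv = xv , [ (λ ()) , (λ ()) ]′ , [ (λ ()) , (λ ()) ]′
  commonNonNeighbour yv0 yv0 = xv , [ (λ ()) , (λ ()) ]′ , [ (λ ()) , (λ ()) ]′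
  commonNonNeighbour yv0 zv0 = xv , [ (λ ()) , (λ ()) ]′ , [ (λ ()) , (λ ()) ]′
  commonNonNeighbour zv0 xv = xv , [ (λ ()) , (λ ()) ]′ , [ (λ ()) , (λ ()) ]′
  commonNonNeighbour zv0 yv0 = xv , [ (λ ()) , (λ ()) ]′ , [ (λ ()) , (λ ()) ]′
  commonNonNeighbour zv0 zv0 = xv , [ (λ ()) , (λ ()) ]′ , [ (λ ()) , (λ ()) ]′
  commonNonNeighbour xv (yv _) = zv0 , [ (λ ()) , (λ ()) ]′ , [ (λ ()) , (λ ()) ]′
  commonNonNeighbour (yv _) xv = zv0 , [ (λ ()) , (λ ()) ]′ , [ (λ ()) , (λ ()) ]′
  commonNonNeighbour zv0 (yv _) = zv0 , [ (λ ()) , (λ ()) ]′ , [ (λ ()) , (λ ()) ]′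
  commonNonNeighbour (yv _) zv0 = zv0 , [ (λ ()) , (λ ()) ]′ , [ (λ ()) , (λ ()) ]′
  commonNonNeighbour (yv _) (yv _) = zv0 , [ (λ ()) , (λ ()) ]′ , [ (λ ()) , (λ ()) ]′
  commonNonNeighbour xv (zv _) = yv0 , [ (λ ()) , (λ ()) ]′ , [ (λ ()) , (λ ()) ]′
  commonNonNeighbour (zv _) xv = yv0 , [ (λ ()) , (λ ()) ]′ , [ (λ ()) , (λ ()) ]′
  commonNonNeighbour yv0 (zv _) = yv0 , [ (λ ()) , (λ ()) ]′ , [ (λ ()) , (λ ()) ]′
  commonNonNeighbour (zv _) yv0 = yv0 , [ (λ ()) , (λ ()) ]′ , [ (λ ()) , (λ ()) ]′
  commonNonNeighbour (zv _) (zv _) = yv0 , [ (λ ()) , (λ ()) ]′ , [ (λ ()) , (λ ()) ]′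

  x-y₁-z₁ : List (V m)
  x-y₁-z₁ = xv ∷ yv fz ∷ zv fz ∷ []

  x-y₁-z₁-unique : Unique x-y₁-z₁
  x-y₁-z₁-unique = ((λ ()) ∷ (λ ()) ∷ []) ∷ ((λ ()) ∷ []) ∷ [] ∷ []

  x-y₁-z₁-totallyDominating : IsTotalDominatingSet (Adj m) x-y₁-z₁
  x-y₁-z₁-totallyDominating xv = yv fz , there (here refl) , inj₁ (e-xyi fz)
  x-y₁-z₁-totallyDominating yv0 = yv fz , there (here refl) , inj₂ (e-yiy fz)
  x-y₁-z₁-totallyDominating zv0 = zv fz , there (there (here refl)) , inj₂ (e-ziz fz)
  x-y₁-z₁-totallyDominating (yv i) = xv , here refl , inj₂ (e-xyi i)
  x-y₁-z₁-totallyDominating (zv k) = xv , here refl , inj₂ (e-xzi k)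

  γₜ≡3 : TotalDominationNumberIs (Adj m) 3
  γₜ≡3 = (x-y₁-z₁ , x-y₁-z₁-unique , x-y₁-z₁-totallyDominating , refl) ,
         λ S _ → commonNonNeighbours⇒3≤length xv commonNonNeighbour S

lemma2p6 : ∀ m → 3 ≤ m → TotalDominationNumberIs (Adj m) 3
lemma2p6 (suc (suc (suc n))) _ = G₄ₘ.γₜ≡3 n
lemma2p6 0 ()
lemma2p6 1 (s≤s ())
lemma2p6 2 (s≤s (s≤s ()))
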